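{- Let $G$ be a graph with an independent set $U$ such that $|U|=s$ and the chromatic number of $G-U$ is $\ell$. Then $\pi_G^{(Q_s)}(k)>0$ for all $k\ge \ell+2$.
   Context: Graphs are finite and simple. $G-U$ is the subgraph induced by $V(G)\setminus U$. $\mathcal{C}_k(G)$ is the graph whose vertices are the proper colorings $V(G)\to\{1,\dots,k\}$, two adjacent iff they differ on exactly one vertex of $G$; $\pi_G^{(H)}(k)$ is the number of induced subgraphs of $\mathcal{C}_k(G)$ isomorphic to $H$. $Q_s$ is the $s$-dimensional hypercube (Cartesian product of $s$ copies of $P_2$). -}

module Defs where

open import Data.Nat using (ℕ; _≤_)
open import Data.Fin using (Fin)
open import Data.Fin.Subset using (Subset; _∈_; _∉_; ∣_∣)
open import Data.Bool using (Bool)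
open import Data.Vec using (Vec; lookup)
open import Data.Product using (Σ; ∃; _×_; proj₁)
open import Relation.Nullary using (¬_)
open import Relation.Binary.PropositionalEquality using (_≡_; _≢_)

record Graph (n : ℕ) : Set₁ where
  field
    Adj    : Fin n → Fin n → Set
    sym    : ∀ {u v} → Adj u v → Adj v u
    irrefl : ∀ {v} → ¬ Adj v v
open Graph public

Independent : ∀ {n} → Graph n → Subset n → Set
Independent G U = ∀ u v → u ∈ U → v ∈ U → ¬ Adj G u v

VertexMinus : ∀ {n} → Subset n → Set
VertexMinus {n} U = Σ (Fin n) (λ v → v ∉ U)

ProperColoringMinus : ∀ {n} → Graph n → Subset n → ℕ → Set
ProperColoringMinus G U m =
  Σ (VertexMinus U → Fin m) λ c →
    ∀ (x y : VertexMinus U) → Adj G (proj₁ x) (proj₁ y) → c x ≢ c y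

ChromaticNumberMinus : ∀ {n} → Graph n → Subset n → ℕ → Set
ChromaticNumberMinus G U ℓ =
  ProperColoringMinus G U ℓ × (∀ m → ProperColoringMinus G U m → ℓ ≤ m)

-- Proper colorings V(G) → {1,…,k} (colours represented by Fin k):
-- the vertices of the coloring graph 𝒞_k(G).
Coloring : ∀ {n} → Graph n → ℕ → Set
Coloring {n} G k = Σ (Fin n → Fin k) λ c → ∀ u v → Adj G u v → c u ≢ c v

DifferExactlyOnce : ∀ {A B : Set} → (A → B) → (A → B) → Set
DifferExactlyOnce {A} f g = ∃ λ (v : A) → f v ≢ g v × (∀ w → w ≢ v → f w ≡ g w)

ColAdj : ∀ {n k} (G : Graph n) → Coloring G k → Coloring G k → Set
ColAdj G c d = DifferExactlyOnce (proj₁ c) (proj₁ d)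

ColEq : ∀ {n k} (G : Graph n) → Coloring G k → Coloring G k → Set
ColEq G c d = ∀ v → proj₁ c v ≡ proj₁ d v

-- The hypercube Q_s: vertices are Vec Bool s, adjacent iff they differ in
-- exactly one coordinate (Cartesian product of s copies of P_2).
QAdj : ∀ {s} → Vec Bool s → Vec Bool s → Set
QAdj x y = DifferExactlyOnce (lookup x) (lookup y)

-- 𝒞_k(G) has an induced subgraph isomorphic to Q_s, i.e. there is an injective
-- map V(Q_s) → V(𝒞_k(G)) preserving and reflecting adjacency.
-- This is exactly π_G^{(Q_s)}(k) > 0.
HasInducedHypercube : ∀ {n} → Graph n → ℕ → ℕ → Set
HasInducedHypercube G k s =
  Σ (Vec Bool s → Coloring G k) λ f →
    (∀ x y → ColEq G (f x) (f y) → x ≡ y) ×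
    (∀ x y → QAdj x y → ColAdj G (f x) (f y)) ×
    (∀ x y → ColAdj G (f x) (f y) → QAdj x y)

{-# OPTIONS --safe #-}
module Submission where

-- Colour G - U properly with ℓ colours and give each vertex of the independent set U one
-- of two fresh colours, chosen by a bit vector x ∈ {0,1}^s.  These 2^s colourings are
-- proper, and two of them differ exactly at the vertices of U where their bit vectors
-- differ, so they span an induced copy of Q_s in 𝒞_k(G).

open import Defs
open import Data.Nat using (ℕ; _≤_; _+_)
open import Data.Fin.Subset using (Subset; ∣_∣)
open import Relation.Binary.PropositionalEquality using (_≡_)

open import Level using (0ℓ)
open import Data.Bool using (Bool; true; false)
open import Data.Empty using (⊥-elim)
open import Data.Fin using (Fin; zero; suc)
open import Data.Fin.Properties using (suc-injective; inject≤-injective; 2↔Bool; +↔⊎)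
open import Data.Fin.Subset using (_∈_; _∉_)
open import Data.Fin.Subset.Properties using (_∈?_)
open import Data.Product using (∃; _,_; proj₁)
open import Data.Sum using (_⊎_; inj₁; inj₂)
open import Data.Sum.Properties using (inj₁-injective; inj₂-injective)
open import Data.Sum.Function.Propositional using (_⊎-↔_)
open import Data.Vec using (Vec; _∷_; lookup)
open import Data.Vec.Base using (here; there)
open import Data.Vec.Relation.Binary.Pointwise.Extensional using (ext; Pointwise-≡⇒≡)
open import Function using (_∘_; _⇔_; _↣_; Injection; Equivalence; mk⇔; mk↣)
open import Function.Definitions using (Injective)
import Function.Properties.Equivalence as ⇔
open import Function.Properties.Inverse using (↔-refl; ↔-sym; ↔⇒↣)
open import Function.Construct.Composition using (_↣-∘_; _↔-∘_)
open import Relation.Nullary using (yes; no)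
import Relation.Binary.Reasoning.Setoid
open import Relation.Binary.PropositionalEquality using (_≢_; _≗_; refl; trans; cong)
import Relation.Binary.PropositionalEquality as ≡

private variable
  A B C : Set

DifferExactlyOnce-cong : {f g : A → B} {f′ g′ : A → C} →
  (∀ a → f a ≡ g a ⇔ f′ a ≡ g′ a) →
  DifferExactlyOnce f g ⇔ DifferExactlyOnce f′ g′
DifferExactlyOnce-cong f≡g⇔f′≡g′ =
  mk⇔ (transport f≡g⇔f′≡g′) (transport (⇔.sym ∘ f≡g⇔f′≡g′))
  where
  transport : ∀ {f g : A → B} {f′ g′ : A → C} → (∀ a → f a ≡ g a ⇔ f′ a ≡ g′ a) →
              DifferExactlyOnce f g → DifferExactlyOnce f′ g′
  transport eqs (a , fa≢ga , rest) =
    a , fa≢ga ∘ Equivalence.from (eqs a) , λ w w≢a → Equivalence.to (eqs w) (rest w w≢a)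

DifferExactlyOnce-∘ˡ : {h : B → C} → Injective _≡_ _≡_ h → {f g : A → B} →
  DifferExactlyOnce (h ∘ f) (h ∘ g) ⇔ DifferExactlyOnce f g
DifferExactlyOnce-∘ˡ {h = h} h-injective =
  DifferExactlyOnce-cong (λ _ → mk⇔ h-injective (cong h))

-- Constructively, "f and g differ only on the image of e" must come with this decision.
DifferExactlyOnce-∘ʳ : {e : A → B} → Injective _≡_ _≡_ e → {f g : B → C} →
  (∀ b → f b ≡ g b ⊎ ∃ λ a → e a ≡ b) →
  DifferExactlyOnce (f ∘ e) (g ∘ e) ⇔ DifferExactlyOnce f g
DifferExactlyOnce-∘ʳ {e = e} e-injective {f} {g} off-image = mk⇔ extend restrict
  where
  extend : DifferExactlyOnce (f ∘ e) (g ∘ e) → DifferExactlyOnce f g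
  extend (a , fea≢gea , rest) = e a , fea≢gea , agree
    where
    agree : ∀ w → w ≢ e a → f w ≡ g w
    agree w w≢ea with off-image w
    ... | inj₁ fw≡gw = fw≡gw
    ... | inj₂ (a′ , refl) = rest a′ (w≢ea ∘ cong e)

  restrict : DifferExactlyOnce f g → DifferExactlyOnce (f ∘ e) (g ∘ e)
  restrict (b , fb≢gb , rest) with off-image b
  ... | inj₁ fb≡gb = ⊥-elim (fb≢gb fb≡gb)
  ... | inj₂ (a , refl) = a , fb≢gb , λ a′ a′≢a → rest (e a′) (a′≢a ∘ e-injective)

enum : ∀ {n} (U : Subset n) → Fin ∣ U ∣ → Fin n
enum (true  ∷ U) zero    = zero
enum (true  ∷ U) (suc i) = suc (enum U i)
enum (false ∷ U) i       = suc (enum U i)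

enum-injective : ∀ {n} (U : Subset n) → Injective _≡_ _≡_ (enum U)
enum-injective (true  ∷ U) {zero}  {zero}  _ = refl
enum-injective (true  ∷ U) {suc i} {suc j} e = cong suc (enum-injective U (suc-injective e))
enum-injective (false ∷ U)                 e = enum-injective U (suc-injective e)

enum-surjective : ∀ {n} (U : Subset n) {u} → u ∈ U → ∃ λ i → enum U i ≡ u
enum-surjective (true ∷ U) here = zero , refl
enum-surjective (true ∷ U) (there u∈U) with enum-surjective U u∈U
... | i , refl = suc i , refl
enum-surjective (false ∷ U) (there u∈U) with enum-surjective U u∈U
... | i , refl = i , refl

scatter : ∀ {n} (U : Subset n) → Vec Bool ∣ U ∣ → Fin n → Bool
scatter (true  ∷ U) (b ∷ x) zero    = b
scatter (true  ∷ U) (b ∷ x) (suc v) = scatter U x v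
scatter (false ∷ U) x       zero    = false
scatter (false ∷ U) x       (suc v) = scatter U x v

scatter-enum : ∀ {n} (U : Subset n) x → scatter U x ∘ enum U ≗ lookup x
scatter-enum (true  ∷ U) (b ∷ x) zero    = refl
scatter-enum (true  ∷ U) (b ∷ x) (suc i) = scatter-enum U x i
scatter-enum (false ∷ U) x       i       = scatter-enum U x i

scatter-∉ : ∀ {n} (U : Subset n) x {v} → v ∉ U → scatter U x v ≡ false
scatter-∉ (true  ∷ U) (b ∷ x) {zero}  v∉U = ⊥-elim (v∉U here)
scatter-∉ (true  ∷ U) (b ∷ x) {suc v} v∉U = scatter-∉ U x (v∉U ∘ there)
scatter-∉ (false ∷ U) x       {zero}  v∉U = refl
scatter-∉ (false ∷ U) x       {suc v} v∉U = scatter-∉ U x (v∉U ∘ there)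

scatter-≡-∉ : ∀ {n} (U : Subset n) x y {v} → v ∉ U → scatter U x v ≡ scatter U y v
scatter-≡-∉ U x y v∉U = trans (scatter-∉ U x v∉U) (≡.sym (scatter-∉ U y v∉U))

DifferExactlyOnce-scatter : ∀ {n} (U : Subset n) (x y : Vec Bool ∣ U ∣) →
  DifferExactlyOnce (scatter U x) (scatter U y) ⇔ QAdj x y
DifferExactlyOnce-scatter U x y = ⇔.trans
  (⇔.sym (DifferExactlyOnce-∘ʳ (enum-injective U) agree-off-U))
  (DifferExactlyOnce-cong λ i →
    subst₂-⇔ (scatter-enum U x i) (scatter-enum U y i))
  where
  agree-off-U : ∀ v → scatter U x v ≡ scatter U y v ⊎ ∃ λ i → enum U i ≡ v
  agree-off-U v with v ∈? U
  ... | yes v∈U = inj₂ (enum-surjective U v∈U)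
  ... | no  v∉U = inj₁ (scatter-≡-∉ U x y v∉U)

  subst₂-⇔ : ∀ {a b a′ b′ : Bool} → a ≡ a′ → b ≡ b′ → a ≡ b ⇔ a′ ≡ b′
  subst₂-⇔ refl refl = ⇔.refl

palette↣ : ∀ {ℓ k} → ℓ + 2 ≤ k → (Fin ℓ ⊎ Bool) ↣ Fin k
palette↣ ℓ+2≤k =
  mk↣ (inject≤-injective ℓ+2≤k ℓ+2≤k _ _)
    ↣-∘ ↔⇒↣ (↔-sym +↔⊎ ↔-∘ (↔-refl ⊎-↔ ↔-sym 2↔Bool))

module _ {n ℓ k} (G : Graph n) (U : Subset n) (independent : Independent G U)
         (c : VertexMinus U → Fin ℓ)
         (c-proper : ∀ u v → Adj G (proj₁ u) (proj₁ v) → c u ≢ c v)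
         (code : (Fin ℓ ⊎ Bool) ↣ Fin k) where

  open Injection code using (to; injective)

  palette : Vec Bool ∣ U ∣ → Fin n → Fin ℓ ⊎ Bool
  palette x v with v ∈? U
  ... | yes _   = inj₂ (scatter U x v)
  ... | no  v∉U = inj₁ (c (v , v∉U))

  palette-proper : ∀ x u v → Adj G u v → palette x u ≢ palette x v
  palette-proper x u v uv with u ∈? U | v ∈? U
  ... | yes u∈U | yes v∈U = ⊥-elim (independent u v u∈U v∈U uv)
  ... | yes _   | no  _   = λ ()
  ... | no  _   | yes _   = λ ()
  ... | no  u∉U | no  v∉U = c-proper (u , u∉U) (v , v∉U) uv ∘ inj₁-injective

  palette-≡⇔ : ∀ x y v → palette x v ≡ palette y v ⇔ scatter U x v ≡ scatter U y v
  palette-≡⇔ x y v with v ∈? U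
  ... | yes _   = mk⇔ inj₂-injective (cong inj₂)
  ... | no  v∉U = mk⇔ (λ _ → scatter-≡-∉ U x y v∉U) (λ _ → refl)

  colouring : Vec Bool ∣ U ∣ → Coloring G k
  colouring x = to ∘ palette x , λ u v uv → palette-proper x u v uv ∘ injective

  colouring-injective : ∀ x y → ColEq G (colouring x) (colouring y) → x ≡ y
  colouring-injective x y same = Pointwise-≡⇒≡ (ext λ i →
    begin
      lookup x i               ≡⟨ ≡.sym (scatter-enum U x i) ⟩
      scatter U x (enum U i)   ≡⟨ Equivalence.to (palette-≡⇔ x y (enum U i)) (injective (same (enum U i))) ⟩
      scatter U y (enum U i)   ≡⟨ scatter-enum U y i ⟩
      lookup y i               ∎)
    where open ≡.≡-Reasoning

  colouring-adjacent⇔ : ∀ x y → ColAdj G (colouring x) (colouring y) ⇔ QAdj x y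
  colouring-adjacent⇔ x y =
    begin
      DifferExactlyOnce (to ∘ palette x) (to ∘ palette y) ≈⟨ DifferExactlyOnce-∘ˡ injective ⟩
      DifferExactlyOnce (palette x) (palette y)           ≈⟨ DifferExactlyOnce-cong (palette-≡⇔ x y) ⟩
      DifferExactlyOnce (scatter U x) (scatter U y)       ≈⟨ DifferExactlyOnce-scatter U x y ⟩
      QAdj x y                                            ∎
    where open Relation.Binary.Reasoning.Setoid (⇔.⇔-setoid 0ℓ)

  inducedHypercube : HasInducedHypercube G k ∣ U ∣
  inducedHypercube =
    colouring , colouring-injective ,
    (λ x y → Equivalence.from (colouring-adjacent⇔ x y)) ,
    (λ x y → Equivalence.to (colouring-adjacent⇔ x y))

corollary5p9 : ∀ {n} (G : Graph n) (U : Subset n) (s ℓ : ℕ) →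
    Independent G U → ∣ U ∣ ≡ s → ChromaticNumberMinus G U ℓ →
    ∀ k → ℓ + 2 ≤ k → HasInducedHypercube G k s
corollary5p9 G U _ ℓ independent refl ((c , c-proper) , _) k ℓ+2≤k =
  inducedHypercube G U independent c c-proper (palette↣ ℓ+2≤k)
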